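{- Let $M$ be a $0/\pm 1$ matrix, let $X=\mathrm{Geom}(M)$ be its geometric grid class, and let $\mathcal{G}_X=\{G_\pi : \pi\in X\}$ be the corresponding class of permutation graphs. Then there is a finite integer $k$ such that every graph in $\mathcal{G}_X$ is a $k$-letter graph.
   Context: Permutation graph: for a permutation $\pi$ of $\{1,\dots,n\}$, $G_\pi$ has vertex set $\{1,\dots,n\}$, with $i$ and $j$ adjacent iff $(i-j)(\pi(i)-\pi(j))<0$. Geometric grid class: matrices are indexed first by column (left to right) and then by row (bottom to top). For a $t\times u$ matrix $M$ with entries in $\{0,1,-1\}$, its standard figure is the subset of $\mathbb{R}^2$ consisting, for each $(k,\ell)$, of the open line segment from $(k-1,\ell-1)$ to $(k,\ell)$ if $M_{k,\ell}=1$, or the open segment from $(k-1,\ell)$ to $(k,\ell-1)$ if $M_{k,\ell}=-1$ (nothing if $M_{k,\ell}=0$). $\mathrm{Geom}(M)$ is the set of all permutations obtained as follows: choose $n$ points on the standard figure, no two on a common horizontal or vertical line, label them $1,\dots,n$ from bottom to top, and read the labels from left to right. Letter graphs: for a finite alphabet $\Sigma$, a decoder $\mathcal{P}\subseteq\Sigma^2$ (a set of ordered pairs), and a word $w=w_1\cdots w_n$ over $\Sigma$, the letter graph $G(\mathcal{P},w)$ has vertex set $\{1,\dots,n\}$, where $i<j$ are adjacent iff $(w_i,w_j)\in\mathcal{P}$. The lettericity of a graph $G$ is the minimum $\ell$ such that $G$ is isomorphic to $G(\mathcal{P},w)$ for some alphabet $\Sigma$ with $|\Sigma|=\ell$, some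 decoder $\mathcal{P}\subseteq\Sigma^2$ and some word $w$ over $\Sigma$. A graph is a $k$-letter graph if its lettericity is at most $k$.
   Formalization: The points chosen on the standard figure in defining $\mathrm{Geom}(M)$ have rational coordinates instead of real ones. -}

module Defs where

open import Data.Nat using (ℕ; _≤_)
open import Data.Integer using (+_)
open import Data.Fin using (Fin; toℕ) renaming (_<_ to _<ᶠ_)
open import Data.Fin.Permutation using (Permutation′; _⟨$⟩ʳ_)
open import Data.Rational using (ℚ; 0ℚ; 1ℚ; _+_; _-_; _/_) renaming (_<_ to _<ℚ_)
open import Data.Bool using (Bool; true)
open import Data.Product using (Σ; ∃; _×_)
open import Data.Sum using (_⊎_)
open import Function.Bundles using (_⇔_)
open import Relation.Binary.PropositionalEquality using (_≡_)

data Entry : Set where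
  e0 e+ e- : Entry

-- A t × u matrix, indexed first by column (left to right, Fin t),
-- then by row (bottom to top, Fin u).
Matrix : ℕ → ℕ → Set
Matrix t u = Fin t → Fin u → Entry

ℕtoℚ : ℕ → ℚ
ℕtoℚ k = (+ k) / 1

-- A point on the standard figure of M: a cell (k , l) (0-indexed, so the
-- cell is [k,k+1] × [l,l+1]) with nonzero entry, and a parameter s with
-- 0 < s < 1 giving the position along the open segment.
record FigPoint {t u : ℕ} (M : Matrix t u) : Set where
  constructor fp
  field
    col   : Fin t
    row   : Fin u
    s     : ℚ
    0<s   : 0ℚ <ℚ s
    s<1   : s <ℚ 1ℚ

xcoord : ∀ {t u} {M : Matrix t u} → FigPoint M → ℚ
xcoord p = ℕtoℚ (toℕ (FigPoint.col p)) + FigPoint.s p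

-- y-coordinate: l + s on a (+1)-cell (segment from (k,l) to (k+1,l+1)),
-- l + (1 - s) on a (-1)-cell (segment from (k,l+1) to (k+1,l)).
ycoordE : Entry → ℕ → ℚ → ℚ
ycoordE e- l s = ℕtoℚ l + (1ℚ - s)
ycoordE _  l s = ℕtoℚ l + s

ycoord : ∀ {t u} {M : Matrix t u} → FigPoint M → ℚ
ycoord {M = M} p =
  ycoordE (M (FigPoint.col p) (FigPoint.row p)) (toℕ (FigPoint.row p)) (FigPoint.s p)

OnFigure : ∀ {t u} {M : Matrix t u} → FigPoint M → Set
OnFigure {M = M} p = (M (FigPoint.col p) (FigPoint.row p) ≡ e0) → Data.Empty.⊥
  where import Data.Empty

-- π ∈ Geom(M): there are n points on the standard figure, the i-th from the
-- left being p i (x-coordinates strictly increasing in i), whose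
-- bottom-to-top labels read left to right give π, i.e. the y-order of the
-- points agrees with the order of the values π(i).
InGeom : ∀ {t u} (M : Matrix t u) {n : ℕ} → Permutation′ n → Set
InGeom M {n} π =
  Σ (Fin n → FigPoint M) λ p →
    (∀ i → OnFigure (p i)) ×
    (∀ i j → i <ᶠ j → xcoord (p i) <ℚ xcoord (p j)) ×
    (∀ i j → (π ⟨$⟩ʳ i) <ᶠ (π ⟨$⟩ʳ j) → ycoord (p i) <ℚ ycoord (p j))

Graph : ℕ → Set₁
Graph n = Fin n → Fin n → Set

PermGraph : ∀ {n} → Permutation′ n → Graph n
PermGraph π i j =
  (i <ᶠ j × (π ⟨$⟩ʳ j) <ᶠ (π ⟨$⟩ʳ i)) ⊎ (j <ᶠ i × (π ⟨$⟩ʳ i) <ᶠ (π ⟨$⟩ʳ j))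

-- Letter graph G(P, w) over alphabet Fin ℓ, decoder P ⊆ Σ² (as a Boolean
-- indicator of ordered pairs), word w of length n: i < j adjacent iff
-- (w_i , w_j) ∈ P.
LetterGraph : ∀ {ℓ n} → (Fin ℓ → Fin ℓ → Bool) → (Fin n → Fin ℓ) → Graph n
LetterGraph P w i j =
  (i <ᶠ j × P (w i) (w j) ≡ true) ⊎ (j <ᶠ i × P (w j) (w i) ≡ true)

_≅_ : ∀ {n m} → Graph n → Graph m → Set
_≅_ {n} {m} G H =
  Σ (Data.Fin.Permutation.Permutation n m) λ σ →
    ∀ i j → G i j ⇔ H (σ ⟨$⟩ʳ i) (σ ⟨$⟩ʳ j)

IsLetterGraph : ℕ → ∀ {n} → Graph n → Set
IsLetterGraph k {n} G =
  Σ ℕ λ ℓ → ℓ ≤ k × ∃ λ m →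
    Σ (Fin ℓ → Fin ℓ → Bool) λ P → Σ (Fin m → Fin ℓ) λ w →
      G ≅ LetterGraph P w

{-# OPTIONS --safe #-}
module Submission where

-- Write each coordinate of a point of the figure as k + g, with k a cell index and 0 < g < 1,
-- and list the points by increasing distance ∣g - ½∣ from the midpoints of their segments (g is s
-- or 1 - s, so this distance is the same for both coordinates). If p comes before q and they
-- share a column, then ∣g_p - ½∣ ≤ ∣g_q - ½∣ puts q to the right of p exactly when g_q ≥ ½;
-- across columns the column indices decide. The same holds for rows, so whether p and q are
-- inverted, i.e. adjacent in G_π, is decided by the letters (column, g_x ≥ ½, row, g_y ≥ ½) of
-- p and q: 4tu letters suffice.

open import Defs
open import Data.Nat as ℕ using (ℕ; suc; _*_)
import Data.Nat.Properties as ℕ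
open import Data.Integer using (+_)
import Data.Integer as ℤ
import Data.Integer.Properties as ℤ
import Data.Nat.Coprimality as Coprime
open import Data.Fin as Fin using (Fin; toℕ; fromℕ; punchIn; punchOut)
import Data.Fin.Properties as Fin
open import Data.Fin.Permutation as Perm using (Permutation′; _⟨$⟩ʳ_; _⟨$⟩ˡ_)
open import Data.Rational as ℚ using (ℚ; mkℚ; 0ℚ; 1ℚ; ½; _+_; _-_; -_; ∣_∣; _<_; _≤_)
import Data.Rational.Properties as ℚ
open import Data.Rational.Solver using (module +-*-Solver)
open import Data.Bool using (Bool; true; false; _xor_)
open import Data.Product using (Σ; ∃; _×_; _,_; proj₁; proj₂)
open import Data.Product.Function.NonDependent.Propositional using (_×-↔_)
open import Data.Sum using (inj₁; inj₂; swap)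
open import Data.Empty using (⊥-elim)
open import Function using (_∘_)
open import Function.Bundles using (_⇔_; mk⇔; _↔_; Inverse; Equivalence)
open import Function.Properties.Inverse using (↔-refl; ↔-sym; ↔-trans)
import Function.Properties.Equivalence as ⇔
open import Relation.Binary.Bundles using (TotalPreorder)
open import Relation.Binary.Definitions using (tri<; tri≈; tri>)
open import Relation.Nullary using (¬_; Dec; yes; no; does; contradiction)
open import Relation.Binary.PropositionalEquality

module _ {c ℓ₁ ℓ₂} (T : TotalPreorder c ℓ₁ ℓ₂) where
  open TotalPreorder T using (Carrier; _≲_; total) renaming (refl to ≲-refl; trans to ≲-trans)

  SortedBy : ∀ {n} → (Fin n → Carrier) → Permutation′ n → Set ℓ₂
  SortedBy f σ = ∀ i j → σ ⟨$⟩ʳ i Fin.< σ ⟨$⟩ʳ j → f i ≲ f j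

  argmax : ∀ {n} (f : Fin (suc n) → Carrier) → Σ (Fin (suc n)) λ j → ∀ i → f i ≲ f j
  argmax {ℕ.zero} f = Fin.zero , λ { Fin.zero → ≲-refl }
  argmax {suc n} f with argmax (f ∘ Fin.suc)
  ... | j , max with total (f Fin.zero) (f (Fin.suc j))
  ...   | inj₁ le = Fin.suc j , λ { Fin.zero → le ; (Fin.suc i) → max i }
  ...   | inj₂ ge = Fin.zero , λ { Fin.zero → ≲-refl ; (Fin.suc i) → ≲-trans (max i) ge }

  sortingPermutation : ∀ {n} (f : Fin n → Carrier) → Σ (Permutation′ n) (SortedBy f)
  sortingPermutation {ℕ.zero} f = Perm.id , λ ()
  sortingPermutation {suc n} f with argmax f
  ... | j , max with sortingPermutation (f ∘ punchIn j)
  ...   | τ , sorted = σ , sortedσ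
    where
    σ : Permutation′ (suc n)
    σ = Perm.insert j (fromℕ n) τ
    σj≡last : σ ⟨$⟩ʳ j ≡ fromℕ n
    σj≡last with j Fin.≟ j
    ... | yes _ = refl
    ... | no j≢j = contradiction refl j≢j
    sortedσ : SortedBy f σ
    sortedσ a b σa<σb with b Fin.≟ j
    ... | yes refl = max a
    ... | no b≢j with a Fin.≟ j
    ...   | yes refl = ⊥-elim (ℕ.<⇒≱ σa<σb (subst (toℕ (σ ⟨$⟩ʳ b) ℕ.≤_)
              (sym (trans (cong toℕ σj≡last) (Fin.toℕ-fromℕ n))) (Fin.toℕ≤pred[n] (σ ⟨$⟩ʳ b))))
    ...   | no a≢j = subst₂ (λ x y → f x ≲ f y) (Fin.punchIn-punchOut j≢a) (Fin.punchIn-punchOut j≢b)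
              (sorted a′ b′ (Fin.≤∧≢⇒< (Fin.punchIn-cancel-≤ (fromℕ n) _ _ (ℕ.<⇒≤ σa′<σb′)) τa′≢τb′))
      where
      j≢a : j ≢ a
      j≢a = a≢j ∘ sym
      j≢b : j ≢ b
      j≢b = b≢j ∘ sym
      a′ b′ : Fin n
      a′ = punchOut j≢a
      b′ = punchOut j≢b
      σa′<σb′ : punchIn (fromℕ n) (τ ⟨$⟩ʳ a′) Fin.< punchIn (fromℕ n) (τ ⟨$⟩ʳ b′)
      σa′<σb′ = subst₂ Fin._<_
        (trans (cong (σ ⟨$⟩ʳ_) (sym (Fin.punchIn-punchOut j≢a))) (Perm.insert-punchIn j (fromℕ n) τ a′))
        (trans (cong (σ ⟨$⟩ʳ_) (sym (Fin.punchIn-punchOut j≢b))) (Perm.insert-punchIn j (fromℕ n) τ b′))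
        σa<σb
      τa′≢τb′ : τ ⟨$⟩ʳ a′ ≢ τ ⟨$⟩ʳ b′
      τa′≢τb′ eq = Fin.<-irrefl (cong (punchIn (fromℕ n)) eq) σa′<σb′

Oriented : ∀ {a r} {A : Set a} → (A → A → Set r) → Bool → A → A → Set r
Oriented _≺_ true  x y = x ≺ y
Oriented _≺_ false x y = y ≺ x

private
  module Solve = +-*-Solver
  open Solve using (_:+_; _:-_; :-_; _:=_)

  sub-add : ∀ p q → (p - q) + q ≡ p
  sub-add = Solve.solve 2 (λ p q → (p :- q) :+ q := p) refl

  neg-sub : ∀ p q → - p - - q ≡ - (p - q)
  neg-sub = Solve.solve 2 (λ p q → (:- p) :- (:- q) := :- (p :- q)) refl

  neg-involutive : ∀ p → - - p ≡ p
  neg-involutive = Solve.solve 1 (λ p → :- (:- p) := p) refl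

ℚ-≤∧≢⇒< : ∀ {p q} → p ≤ q → p ≢ q → p < q
ℚ-≤∧≢⇒< {p} {q} p≤q p≢q with ℚ.<-cmp p q
... | tri< p<q _ _ = p<q
... | tri≈ _ p≡q _ = contradiction p≡q p≢q
... | tri> _ _ q<p = ⊥-elim (ℚ.<-irrefl refl (ℚ.<-≤-trans q<p p≤q))

p≤∣p∣ : ∀ p → p ≤ ∣ p ∣
p≤∣p∣ p with 0ℚ ℚ.≤? p
... | yes 0≤p = ℚ.≤-reflexive (sym (ℚ.0≤p⇒∣p∣≡p 0≤p))
... | no 0≰p = ℚ.≤-trans (ℚ.<⇒≤ (ℚ.≰⇒> 0≰p)) (ℚ.0≤∣p∣ p)

sub-cancelʳ-≤ : ∀ {p q} r → p - r ≤ q - r → p ≤ q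
sub-cancelʳ-≤ {p} {q} r le = subst₂ _≤_ (sub-add p r) (sub-add q r) (ℚ.+-monoˡ-≤ r le)

p≤q⇒0≤q-p : ∀ {p q} → p ≤ q → 0ℚ ≤ q - p
p≤q⇒0≤q-p {p} {q} p≤q = subst (_≤ q - p) (ℚ.+-inverseʳ p) (ℚ.+-monoˡ-≤ (- p) p≤q)

closer-≤-above : ∀ {a b c} → ∣ a - c ∣ ≤ ∣ b - c ∣ → c ≤ b → a ≤ b
closer-≤-above {a} {b} {c} closer c≤b = sub-cancelʳ-≤ c (begin
  a - c       ≤⟨ p≤∣p∣ (a - c) ⟩
  ∣ a - c ∣   ≤⟨ closer ⟩
  ∣ b - c ∣   ≡⟨ ℚ.0≤p⇒∣p∣≡p (p≤q⇒0≤q-p c≤b) ⟩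
  b - c       ∎)
  where open ℚ.≤-Reasoning

closer-≤-below : ∀ {a b c} → ∣ a - c ∣ ≤ ∣ b - c ∣ → b ≤ c → b ≤ a
closer-≤-below {a} {b} {c} closer b≤c =
  subst₂ _≤_ (neg-involutive b) (neg-involutive a)
    (ℚ.neg-antimono-≤ (closer-≤-above negated (ℚ.neg-antimono-≤ b≤c)))
  where
  ∣neg-sub∣ : ∀ p → ∣ - p - - c ∣ ≡ ∣ p - c ∣
  ∣neg-sub∣ p = trans (cong ∣_∣ (neg-sub p c)) (ℚ.∣-p∣≡∣p∣ (p - c))
  negated : ∣ - a - - c ∣ ≤ ∣ - b - - c ∣
  negated = subst₂ _≤_ (sym (∣neg-sub∣ a)) (sym (∣neg-sub∣ b)) closer

centre-order : ∀ {a b c} → ∣ a - c ∣ ≤ ∣ b - c ∣ → a ≢ b →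
  (c≤?b : Dec (c ≤ b)) → Oriented _<_ (does c≤?b) a b
centre-order closer a≢b (yes c≤b) = ℚ-≤∧≢⇒< (closer-≤-above closer c≤b) a≢b
centre-order closer a≢b (no c≰b)  = ℚ-≤∧≢⇒< (closer-≤-below closer (ℚ.<⇒≤ (ℚ.≰⇒> c≰b))) (a≢b ∘ sym)

ℕtoℚ≡mkℚ : ∀ k → ℕtoℚ k ≡ mkℚ (+ k) 0 (Coprime.sym (Coprime.1-coprimeTo k))
ℕtoℚ≡mkℚ k = ℚ.↥p/↧p≡p (mkℚ (+ k) 0 (Coprime.sym (Coprime.1-coprimeTo k)))

ℕtoℚ-mono-≤ : ∀ {k k′} → k ℕ.≤ k′ → ℕtoℚ k ≤ ℕtoℚ k′
ℕtoℚ-mono-≤ {k} {k′} k≤k′ rewrite ℕtoℚ≡mkℚ k | ℕtoℚ≡mkℚ k′ =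
  ℚ.*≤* (subst₂ ℤ._≤_ (sym (ℤ.*-identityʳ (+ k))) (sym (ℤ.*-identityʳ (+ k′))) (ℤ.+≤+ k≤k′))

ℕtoℚ-suc : ∀ k → ℕtoℚ k + 1ℚ ≡ ℕtoℚ (suc k)
ℕtoℚ-suc k rewrite ℕtoℚ≡mkℚ k | ℤ.*-identityʳ (+ k) | ℕ.+-comm k 1 = refl

index-dominates : ∀ {k k′ g g′} → k ℕ.< k′ → g < 1ℚ → 0ℚ < g′ → ℕtoℚ k + g < ℕtoℚ k′ + g′
index-dominates {k} {k′} {g} {g′} k<k′ g<1 0<g′ = begin-strict
  ℕtoℚ k + g     <⟨ ℚ.+-monoʳ-< (ℕtoℚ k) g<1 ⟩
  ℕtoℚ k + 1ℚ    ≡⟨ ℕtoℚ-suc k ⟩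
  ℕtoℚ (suc k)   ≤⟨ ℕtoℚ-mono-≤ k<k′ ⟩
  ℕtoℚ k′        ≡⟨ ℚ.+-identityʳ (ℕtoℚ k′) ⟨
  ℕtoℚ k′ + 0ℚ   <⟨ ℚ.+-monoʳ-< (ℕtoℚ k′) 0<g′ ⟩
  ℕtoℚ k′ + g′   ∎
  where open ℚ.≤-Reasoning

Oriented-+ : ∀ h q {x y} → Oriented _<_ h x y → Oriented _<_ h (q + x) (q + y)
Oriented-+ true  q = ℚ.+-monoʳ-< q
Oriented-+ false q = ℚ.+-monoʳ-< q

before : ℕ → ℕ → Bool → Bool
before k k′ tie with ℕ.<-cmp k k′
... | tri< _ _ _ = true
... | tri≈ _ _ _ = tie
... | tri> _ _ _ = false

offset-order : ∀ k k′ {g g′} → 0ℚ < g → g < 1ℚ → 0ℚ < g′ → g′ < 1ℚ →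
  ∣ g - ½ ∣ ≤ ∣ g′ - ½ ∣ → ℕtoℚ k + g ≢ ℕtoℚ k′ + g′ →
  Oriented _<_ (before k k′ (does (½ ℚ.≤? g′))) (ℕtoℚ k + g) (ℕtoℚ k′ + g′)
offset-order k k′ {g} {g′} 0<g g<1 0<g′ g′<1 closer ≢ with ℕ.<-cmp k k′
... | tri< k<k′ _ _ = index-dominates k<k′ g<1 0<g′
... | tri≈ _ refl _ =
  Oriented-+ (does (½ ℚ.≤? g′)) (ℕtoℚ k) (centre-order closer (≢ ∘ cong (ℕtoℚ k ℚ.+_)) (½ ℚ.≤? g′))
... | tri> _ _ k′<k = index-dominates k′<k g′<1 0<g

yoffset : Entry → ℚ → ℚ
yoffset e- s = 1ℚ - s
yoffset _  s = s

ycoordE-offset : ∀ e l s → ycoordE e l s ≡ ℕtoℚ l + yoffset e s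
ycoordE-offset e0 l s = refl
ycoordE-offset e+ l s = refl
ycoordE-offset e- l s = refl

yoffset-bounds : ∀ e {s} → 0ℚ < s → s < 1ℚ → 0ℚ < yoffset e s × yoffset e s < 1ℚ
yoffset-bounds e0 0<s s<1 = 0<s , s<1
yoffset-bounds e+ 0<s s<1 = 0<s , s<1
yoffset-bounds e- 0<s s<1 =
  ℚ.+-monoʳ-< 1ℚ (ℚ.neg-antimono-< s<1) , ℚ.+-monoʳ-< 1ℚ (ℚ.neg-antimono-< 0<s)

yoffset-centre : ∀ e s → ∣ yoffset e s - ½ ∣ ≡ ∣ s - ½ ∣
yoffset-centre e0 s = refl
yoffset-centre e+ s = refl
yoffset-centre e- s = trans (cong ∣_∣ (reflect s)) (ℚ.∣-p∣≡∣p∣ (s - ½))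
  where
  open Solve using (con)
  reflect : ∀ s → (1ℚ - s) - ½ ≡ - (s - ½)
  reflect = Solve.solve 1 (λ s → (con 1ℚ :- s) :- con ½ := :- (s :- con ½)) refl

centreDistance : ∀ {t u} {M : Matrix t u} → FigPoint M → ℚ
centreDistance p = ∣ FigPoint.s p - ½ ∣

CoordLetter : ℕ → Set
CoordLetter m = Fin m × Bool

coordLetter : ∀ {m} → Fin m → ℚ → CoordLetter m
coordLetter k g = k , does (½ ℚ.≤? g)

coordBefore : ∀ {m} → CoordLetter m → CoordLetter m → Bool
coordBefore (k , _) (k′ , tie) = before (toℕ k) (toℕ k′) tie

Letter : ℕ → ℕ → Set
Letter t u = CoordLetter t × CoordLetter u

decoder : ∀ {t u} → Letter t u → Letter t u → Bool
decoder (x , y) (x′ , y′) = coordBefore x x′ xor coordBefore y y′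

module _ {t u} {M : Matrix t u} where
  open FigPoint

  yoffsetᶠ : FigPoint M → ℚ
  yoffsetᶠ p = yoffset (M (col p) (row p)) (s p)

  letter : FigPoint M → Letter t u
  letter p = coordLetter (col p) (s p) , coordLetter (row p) (yoffsetᶠ p)

  xcoord-oriented : ∀ (p q : FigPoint M) → centreDistance p ≤ centreDistance q → xcoord p ≢ xcoord q →
    Oriented _<_ (coordBefore (proj₁ (letter p)) (proj₁ (letter q))) (xcoord p) (xcoord q)
  xcoord-oriented p q = offset-order (toℕ (col p)) (toℕ (col q)) (0<s p) (s<1 p) (0<s q) (s<1 q)

  ycoord-oriented : ∀ (p q : FigPoint M) → centreDistance p ≤ centreDistance q → ycoord p ≢ ycoord q →
    Oriented _<_ (coordBefore (proj₂ (letter p)) (proj₂ (letter q))) (ycoord p) (ycoord q)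
  ycoord-oriented p q closer yp≢yq =
    subst₂ (Oriented _<_ (coordBefore (proj₂ (letter p)) (proj₂ (letter q))))
      (sym (ycoord≡ p)) (sym (ycoord≡ q))
      (offset-order (toℕ (row p)) (toℕ (row q))
        (proj₁ (bounds p)) (proj₂ (bounds p)) (proj₁ (bounds q)) (proj₂ (bounds q))
        (subst₂ _≤_ (sym (centre p)) (sym (centre q)) closer)
        (λ eq → yp≢yq (trans (ycoord≡ p) (trans eq (sym (ycoord≡ q))))))
    where
    ycoord≡ : ∀ p → ycoord p ≡ ℕtoℚ (toℕ (row p)) + yoffsetᶠ p
    ycoord≡ p = ycoordE-offset (M (col p) (row p)) (toℕ (row p)) (s p)
    bounds : ∀ p → 0ℚ < yoffsetᶠ p × yoffsetᶠ p < 1ℚ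
    bounds p = yoffset-bounds (M (col p) (row p)) (0<s p) (s<1 p)
    centre : ∀ p → ∣ yoffsetᶠ p - ½ ∣ ≡ centreDistance p
    centre p = yoffset-centre (M (col p) (row p)) (s p)

perm-injective : ∀ {n} (π : Permutation′ n) {i j} → π ⟨$⟩ʳ i ≡ π ⟨$⟩ʳ j → i ≡ j
perm-injective π {i} {j} eq = trans (sym (Perm.inverseˡ π)) (trans (cong (π ⟨$⟩ˡ_) eq) (Perm.inverseˡ π))

module _ {n} (π : Permutation′ n) (f : Fin n → ℚ) (mono : ∀ i j → π ⟨$⟩ʳ i Fin.< π ⟨$⟩ʳ j → f i < f j) where

  rank-≢ : ∀ {i j} → π ⟨$⟩ʳ i ≢ π ⟨$⟩ʳ j → f i ≢ f j
  rank-≢ {i} {j} πi≢πj with Fin.<-cmp (π ⟨$⟩ʳ i) (π ⟨$⟩ʳ j)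
  ... | tri< πi<πj _ _ = ℚ.<⇒≢ (mono i j πi<πj)
  ... | tri≈ _ πi≡πj _ = contradiction πi≡πj πi≢πj
  ... | tri> _ _ πj<πi = ℚ.<⇒≢ (mono j i πj<πi) ∘ sym

  rank-oriented : ∀ h {i j} → Oriented _<_ h (f i) (f j) → Oriented Fin._<_ h (π ⟨$⟩ʳ i) (π ⟨$⟩ʳ j)
  rank-oriented true {i} {j} fi<fj with Fin.<-cmp (π ⟨$⟩ʳ i) (π ⟨$⟩ʳ j)
  ... | tri< πi<πj _ _ = πi<πj
  ... | tri≈ _ πi≡πj _ = ⊥-elim (ℚ.<-irrefl (cong f (perm-injective π πi≡πj)) fi<fj)
  ... | tri> _ _ πj<πi = ⊥-elim (ℚ.<-asym fi<fj (mono j i πj<πi))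
  rank-oriented false fj<fi = rank-oriented true fj<fi

PermGraph-irrefl : ∀ {n} (π : Permutation′ n) {i} → ¬ PermGraph π i i
PermGraph-irrefl π (inj₁ (i<i , _)) = Fin.<-irrefl refl i<i
PermGraph-irrefl π (inj₂ (i<i , _)) = Fin.<-irrefl refl i<i

PermGraph-oriented : ∀ {n} (π : Permutation′ n) {i j} hx hy →
  Oriented Fin._<_ hx i j → Oriented Fin._<_ hy (π ⟨$⟩ʳ i) (π ⟨$⟩ʳ j) → PermGraph π i j ⇔ (hx xor hy ≡ true)
PermGraph-oriented π true true i<j πi<πj =
  mk⇔ (λ { (inj₁ (_ , πj<πi)) → ⊥-elim (Fin.<-asym πi<πj πj<πi)
         ; (inj₂ (j<i , _)) → ⊥-elim (Fin.<-asym i<j j<i) })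
      λ ()
PermGraph-oriented π true false i<j πj<πi = mk⇔ (λ _ → refl) (λ _ → inj₁ (i<j , πj<πi))
PermGraph-oriented π false true j<i πi<πj = mk⇔ (λ _ → refl) (λ _ → inj₂ (j<i , πi<πj))
PermGraph-oriented π false false j<i πj<πi =
  mk⇔ (λ { (inj₁ (i<j , _)) → ⊥-elim (Fin.<-asym i<j j<i)
         ; (inj₂ (_ , πi<πj)) → ⊥-elim (Fin.<-asym πi<πj πj<πi) })
      λ ()

isLetterGraph-ordered : ∀ {A : Set} {ℓ n} (G : Graph n) →
  (∀ {i j} → G i j → G j i) → (∀ {i} → ¬ G i i) →
  A ↔ Fin ℓ → (σ : Permutation′ n) (P : A → A → Bool) (L : Fin n → A) →
  (∀ i j → σ ⟨$⟩ʳ i Fin.< σ ⟨$⟩ʳ j → G i j ⇔ (P (L i) (L j) ≡ true)) →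
  IsLetterGraph ℓ G
isLetterGraph-ordered {ℓ = ℓ} {n} G symmetric irreflexive alphabet σ P L adjacency =
  ℓ , ℕ.≤-refl , n , P′ , w , σ , iso
  where
  open Inverse alphabet using (to; from; strictlyInverseʳ)
  P′ : Fin ℓ → Fin ℓ → Bool
  P′ α β = P (from α) (from β)
  w : Fin n → Fin ℓ
  w = to ∘ L ∘ (σ ⟨$⟩ˡ_)
  decode : ∀ i j → P′ (w (σ ⟨$⟩ʳ i)) (w (σ ⟨$⟩ʳ j)) ≡ P (L i) (L j)
  decode i j = cong₂ P (label i) (label j)
    where
    label : ∀ i → from (w (σ ⟨$⟩ʳ i)) ≡ L i
    label i = trans (strictlyInverseʳ _) (cong L (Perm.inverseˡ σ))
  ordered : ∀ {i j} → σ ⟨$⟩ʳ i Fin.< σ ⟨$⟩ʳ j → G i j ⇔ LetterGraph P′ w (σ ⟨$⟩ʳ i) (σ ⟨$⟩ʳ j)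
  ordered {i} {j} σi<σj = mk⇔
    (λ gij → inj₁ (σi<σj , trans (decode i j) (Equivalence.to (adjacency i j σi<σj) gij)))
    λ { (inj₁ (_ , e)) → Equivalence.from (adjacency i j σi<σj) (trans (sym (decode i j)) e)
      ; (inj₂ (σj<σi , _)) → ⊥-elim (Fin.<-asym σi<σj σj<σi) }
  iso : ∀ i j → G i j ⇔ LetterGraph P′ w (σ ⟨$⟩ʳ i) (σ ⟨$⟩ʳ j)
  iso i j with Fin.<-cmp (σ ⟨$⟩ʳ i) (σ ⟨$⟩ʳ j)
  ... | tri< σi<σj _ _ = ordered σi<σj
  ... | tri≈ _ σi≡σj _ = mk⇔ (⊥-elim ∘ irreflexive ∘ subst (G i) (sym (perm-injective σ σi≡σj)))
    λ { (inj₁ (σi<σj , _)) → ⊥-elim (Fin.<-irrefl σi≡σj σi<σj)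
      ; (inj₂ (σj<σi , _)) → ⊥-elim (Fin.<-irrefl (sym σi≡σj) σj<σi) }
  ... | tri> _ _ σj<σi = ⇔.trans (mk⇔ symmetric symmetric) (⇔.trans (ordered σj<σi) (mk⇔ swap swap))

alphabet↔ : ∀ t u → Letter t u ↔ Fin (t * 2 * (u * 2))
alphabet↔ t u = ↔-sym (↔-trans Fin.*↔× (coord↔ ×-↔ coord↔))
  where
  coord↔ : ∀ {m} → Fin (m * 2) ↔ CoordLetter m
  coord↔ = ↔-trans Fin.*↔× (↔-refl ×-↔ Fin.2↔Bool)

-- OnFigure is not needed: the coordinates of Defs treat a zero cell like a (+1)-cell.
geom-isLetterGraph : ∀ {t u} (M : Matrix t u) {n} (π : Permutation′ n) →
  InGeom M π → IsLetterGraph (t * 2 * (u * 2)) (PermGraph π)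
geom-isLetterGraph {t} {u} M {n} π (p , _ , x-mono , y-mono) =
  isLetterGraph-ordered (PermGraph π) swap (PermGraph-irrefl π) (alphabet↔ t u) σ decoder (letter ∘ p) adjacency
  where
  sorting : Σ (Permutation′ n) (SortedBy ℚ.≤-totalPreorder (centreDistance ∘ p))
  sorting = sortingPermutation ℚ.≤-totalPreorder (centreDistance ∘ p)
  σ : Permutation′ n
  σ = proj₁ sorting
  adjacency : ∀ i j → σ ⟨$⟩ʳ i Fin.< σ ⟨$⟩ʳ j →
    PermGraph π i j ⇔ (decoder (letter (p i)) (letter (p j)) ≡ true)
  adjacency i j σi<σj = PermGraph-oriented π hx hy
    (rank-oriented Perm.id (xcoord ∘ p) x-mono hx (xcoord-oriented (p i) (p j) closer x≢))
    (rank-oriented π (ycoord ∘ p) y-mono hy (ycoord-oriented (p i) (p j) closer y≢))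
    where
    hx hy : Bool
    hx = coordBefore (proj₁ (letter (p i))) (proj₁ (letter (p j)))
    hy = coordBefore (proj₂ (letter (p i))) (proj₂ (letter (p j)))
    closer : centreDistance (p i) ≤ centreDistance (p j)
    closer = proj₂ sorting i j σi<σj
    i≢j : i ≢ j
    i≢j i≡j = Fin.<-irrefl (cong (σ ⟨$⟩ʳ_) i≡j) σi<σj
    x≢ : xcoord (p i) ≢ xcoord (p j)
    x≢ = rank-≢ Perm.id (xcoord ∘ p) x-mono i≢j
    y≢ : ycoord (p i) ≢ ycoord (p j)
    y≢ = rank-≢ π (ycoord ∘ p) y-mono (i≢j ∘ perm-injective π)

theorem3 : ∀ (t u : ℕ) (M : Matrix t u) →
    ∃ λ (k : ℕ) → ∀ (n : ℕ) (π : Permutation′ n) →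
    InGeom M π → IsLetterGraph k (PermGraph π)
theorem3 t u M = t * 2 * (u * 2) , λ n π → geom-isLetterGraph M π
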